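{- Let $T$ be a tree with maximum degree $\Delta\ge 3$ and $\ell$ leaves. Then the set of lengths of leaf-to-leaf paths in $T$ has at least $\log_{\Delta-1}((\Delta-2)\ell)$ elements.
   Context: A leaf is a vertex of degree $1$. A leaf-to-leaf path is a path both of whose endpoints are leaves; the length of a path is its number of edges, and a single vertex is considered a path of length $0$ (so every leaf gives a leaf-to-leaf path of length $0$). -}

module Defs where

open import Data.Nat using (ℕ; zero; suc; _≤_)
open import Data.Fin using (Fin)
open import Data.Bool using (Bool; true; false)
open import Data.List using (List; []; _∷_; length; allFin; filterᵇ)
open import Data.Nat using (_≡ᵇ_)
open import Data.List.Relation.Unary.Linked using (Linked)
open import Data.List.Relation.Unary.Unique.Propositional using (Unique)
open import Data.List.Membership.Propositional using (_∈_)
open import Data.Product using (Σ; _×_; ∃; ∃-syntax)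
open import Relation.Binary.PropositionalEquality using (_≡_)
open import Relation.Nullary using (¬_)

record Graph (n : ℕ) : Set where
  field
    adj   : Fin n → Fin n → Bool
    sym   : ∀ u v → adj u v ≡ adj v u
    irrefl : ∀ v → adj v v ≡ false

module _ {n : ℕ} (G : Graph n) where
  open Graph G

  Adj : Fin n → Fin n → Set
  Adj u v = adj u v ≡ true

  degree : Fin n → ℕ
  degree v = length (filterᵇ (adj v) (allFin n))

  IsLeaf : Fin n → Set
  IsLeaf v = degree v ≡ 1

  leafCount : ℕ
  leafCount = length (filterᵇ (λ v → degree v ≡ᵇ 1) (allFin n))

  MaxDegree : ℕ → Set
  MaxDegree Δ = (∃[ v ] degree v ≡ Δ) × (∀ v → degree v ≤ Δ)

  -- a path is a nonempty list of distinct vertices (u ∷ vs) with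
  -- consecutive vertices adjacent; it starts at u and ends at end u vs,
  -- and has length (number of edges) = length vs.
  end : Fin n → List (Fin n) → Fin n
  end u [] = u
  end u (v ∷ vs) = end v vs

  IsPath : Fin n → List (Fin n) → Set
  IsPath u vs = Linked Adj (u ∷ vs) × Unique (u ∷ vs)

  Connected : Set
  Connected = ∀ a b → ∃[ vs ] (IsPath a vs × end a vs ≡ b)

  IsCycle : Fin n → List (Fin n) → Set
  IsCycle u vs = IsPath u vs × (2 ≤ length vs) × Adj (end u vs) u

  Acyclic : Set
  Acyclic = ∀ u vs → ¬ IsCycle u vs

  IsTree : Set
  IsTree = Connected × Acyclic

  -- d is the length of some leaf-to-leaf path (single leaf = length 0)
  IsLeafPathLength : ℕ → Set
  IsLeafPathLength d =
    ∃[ u ] ∃[ vs ] (IsPath u vs × IsLeaf u × IsLeaf (end u vs) × length vs ≡ d)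

{-# OPTIONS --safe #-}
module Submission where

-- Root the tree at a leaf x that ends a longest leaf-to-leaf path x ⋯ z, so that every leaf depth lies in L.
-- If u lies m levels above depth d, the leaves at depth d below u number at most
-- (Δ-1)^#{e ∈ L : 0 < e ≤ min(d, 2m)}: when two children of u have such leaves, these leaves are 2m apart,
-- so 2m ∈ L, and 2m ≤ d because the branch avoiding z would otherwise give a leaf path longer than depth z;
-- otherwise a single child contributes. For u = x, level d carries at most (Δ-1)^#{e ∈ L : 0 < e ≤ d}
-- leaves, and summing over the levels in L gives ℓ ≤ 1 + (Δ-1) + ⋯ + (Δ-1)^(|L|-1).

open import Defs
open import Data.Nat using (ℕ; _≤_; _∸_; _*_; _^_)
open import Data.List using (List; length)
open import Data.List.Relation.Unary.Unique.Propositional using (Unique)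
open import Data.List.Membership.Propositional using (_∈_)
open import Data.Product using (_×_)
open import Function.Bundles using (_⇔_)

open import Data.Bool using (true; false)
import Data.Bool as Bool
open import Data.Bool.Properties using (T-≡)
open import Data.Empty using (⊥-elim)
open import Data.Fin using (Fin) renaming (_≟_ to _≟ᶠ_)
open import Data.List using ([]; _∷_; _++_; [_]; filter; map; allFin; InitLast; initLast; _∷ʳ′_)
open import Data.List.Extrema.Nat using (max; argmax-all; ⊥≤max; xs≤max)
open import Data.List.Membership.Propositional using (_∉_)
open import Data.List.Membership.Propositional.Properties
  using (∈-++⁺ˡ; ∈-++⁺ʳ; ∈-++⁻; ∈-∃++; ∈-allFin; ∈-filter⁺; ∈-filter⁻)
open import Data.List.Properties
  using (≡-dec; ++-assoc; ++-identityʳ; ++-cancelˡ; ∷-injective; ∷-injectiveˡ; length-++;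
         filter-accept; filter-none; filter-notAll)
open import Data.List.Relation.Binary.Disjoint.Propositional using (Disjoint)
open import Data.List.Relation.Binary.Subset.Propositional using (_⊆_)
open import Data.List.Relation.Binary.Sublist.Propositional using (⊆-refl)
open import Data.List.Relation.Binary.Sublist.Propositional.Properties using (length-mono-≤; filter⁺)
open import Data.List.Relation.Unary.All as All using (All; []; _∷_)
import Data.List.Relation.Unary.All.Properties as All
open import Data.List.Relation.Unary.All.Properties using (¬Any⇒All¬; All¬⇒¬Any)
open import Data.List.Relation.Unary.AllPairs using ([]; _∷_)
open import Data.List.Relation.Unary.Any as Any using (here; there)
open import Data.List.Relation.Unary.Any.Properties using (¬Any[])
open import Data.List.Relation.Unary.Linked as Linked using (Linked; []; [-]; _∷_)
import Data.List.Relation.Unary.Unique.Propositional.Properties as Unique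
open import Data.List.Relation.Unary.Unique.Propositional.Properties using (++⁺; allFin⁺)
open import Data.Nat using (zero; suc; _+_; _<_; _⊓_; _≡ᵇ_; z≤n; s≤s; _≟_; _≤?_; _<?_)
open import Data.Nat.ListAction using (sum)
open import Data.Nat.Properties
open import Data.Nat.Tactic.RingSolver using (solve-∀)
open import Data.Product using (∃-syntax; _,_; proj₁; proj₂)
open import Data.Sum using (_⊎_; inj₁; inj₂)
open import Data.Unit using (⊤; tt)
open import Function.Base using (id; _∘_)
open import Function.Bundles using (Equivalence)
open import Level using (0ℓ)
open import Relation.Binary.Definitions using (DecidableEquality)
open import Relation.Binary.PropositionalEquality
  using (_≡_; _≢_; refl; sym; trans; cong; cong₂; subst; subst₂; module ≡-Reasoning)
open import Relation.Nullary using (¬_; Dec; yes; no; does; contradiction; ¬?; _×-dec_)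
open import Relation.Unary using (Pred; Decidable)

module _ {A : Set} where

  lastFrom : A → List A → A
  lastFrom u []       = u
  lastFrom u (v ∷ vs) = lastFrom v vs

  lastFrom-++ : ∀ u xs ys → lastFrom u (xs ++ ys) ≡ lastFrom (lastFrom u xs) ys
  lastFrom-++ u []       ys = refl
  lastFrom-++ u (v ∷ xs) ys = lastFrom-++ v xs ys

  lastFrom-∈ : ∀ u xs → lastFrom u xs ∈ u ∷ xs
  lastFrom-∈ u []       = here refl
  lastFrom-∈ u (v ∷ xs) = there (lastFrom-∈ v xs)

  Unique-head : ∀ {u} {xs : List A} → Unique (u ∷ xs) → u ∉ xs
  Unique-head = Unique.Unique[x∷xs]⇒x∉xs

  Unique-∷ : ∀ {u} {xs : List A} → u ∉ xs → Unique xs → Unique (u ∷ xs)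
  Unique-∷ u∉xs uniq = ¬Any⇒All¬ _ u∉xs ∷ uniq

  Unique-++⁻ˡ : ∀ (xs : List A) {ys} → Unique (xs ++ ys) → Unique xs
  Unique-++⁻ˡ []       _          = []
  Unique-++⁻ˡ (x ∷ xs) (x∉ ∷ uniq) = All.++⁻ˡ xs x∉ ∷ Unique-++⁻ˡ xs uniq

  Unique-++⁻-disjoint : ∀ (xs : List A) {ys} → Unique (xs ++ ys) → Disjoint xs ys
  Unique-++⁻-disjoint (x ∷ xs) (x∉ ∷ _)    (here refl , v∈ys)  = All¬⇒¬Any (All.++⁻ʳ xs x∉) v∈ys
  Unique-++⁻-disjoint (x ∷ xs) (_ ∷ uniq) (there v∈xs , v∈ys) = Unique-++⁻-disjoint xs uniq (v∈xs , v∈ys)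

  module _ {R : A → A → Set} where

    Linked-++⁺ : ∀ u xs ys → Linked R (u ∷ xs) → Linked R (lastFrom u xs ∷ ys) → Linked R (u ∷ xs ++ ys)
    Linked-++⁺ u []       ys _           rest = rest
    Linked-++⁺ u (v ∷ xs) ys (r ∷ linked) rest = r ∷ Linked-++⁺ v xs ys linked rest

    Linked-++⁻ˡ : ∀ u xs ys → Linked R (u ∷ xs ++ ys) → Linked R (u ∷ xs)
    Linked-++⁻ˡ u []       ys _            = [-]
    Linked-++⁻ˡ u (v ∷ xs) ys (r ∷ linked) = r ∷ Linked-++⁻ˡ v xs ys linked

    Linked-++⁻ʳ : ∀ u xs ys → Linked R (u ∷ xs ++ ys) → Linked R (lastFrom u xs ∷ ys)
    Linked-++⁻ʳ u []       ys linked       = linked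
    Linked-++⁻ʳ u (v ∷ xs) ys (_ ∷ linked) = Linked-++⁻ʳ v xs ys linked

  -- lastFrom u p ∷ reverseTail u p is the reversal of u ∷ p.
  reverseTail : A → List A → List A
  reverseTail u []      = []
  reverseTail u (v ∷ p) = reverseTail v p ++ [ u ]

  lastFrom-reverseTail : ∀ u p → lastFrom (lastFrom u p) (reverseTail u p) ≡ u
  lastFrom-reverseTail u []      = refl
  lastFrom-reverseTail u (v ∷ p) = lastFrom-++ (lastFrom v p) (reverseTail v p) [ u ]

  length-reverseTail : ∀ u p → length (reverseTail u p) ≡ length p
  length-reverseTail u []      = refl
  length-reverseTail u (v ∷ p) = begin
    length (reverseTail v p ++ [ u ])  ≡⟨ length-++ (reverseTail v p) ⟩
    length (reverseTail v p) + 1       ≡⟨ +-comm _ 1 ⟩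
    suc (length (reverseTail v p))     ≡⟨ cong suc (length-reverseTail v p) ⟩
    suc (length p)                     ∎
    where open ≡-Reasoning

  ∈-reverse⁻ : ∀ u p {w} → w ∈ lastFrom u p ∷ reverseTail u p → w ∈ u ∷ p
  ∈-reverse⁻ u []      w∈ = w∈
  ∈-reverse⁻ u (v ∷ p) (here refl) = there (lastFrom-∈ v p)
  ∈-reverse⁻ u (v ∷ p) (there w∈) with ∈-++⁻ (reverseTail v p) w∈
  ... | inj₁ w∈rev      = there (∈-reverse⁻ v p (there w∈rev))
  ... | inj₂ (here refl) = here refl

  Unique-reverse : ∀ u p → Unique (u ∷ p) → Unique (lastFrom u p ∷ reverseTail u p)
  Unique-reverse u []      uniq = uniq
  Unique-reverse u (v ∷ p) uniq@(_ ∷ uniq′) =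
    ++⁺ (Unique-reverse v p uniq′) (Unique-∷ (λ ()) [])
        λ { (w∈ , here refl) → Unique-head uniq (∈-reverse⁻ v p w∈) }

  Linked-reverse : ∀ {R : A → A → Set} → (∀ {v w} → R v w → R w v) →
                   ∀ u p → Linked R (u ∷ p) → Linked R (lastFrom u p ∷ reverseTail u p)
  Linked-reverse R-sym u []      linked       = linked
  Linked-reverse R-sym u (v ∷ p) (r ∷ linked) =
    Linked-++⁺ (lastFrom v p) (reverseTail v p) [ u ] (Linked-reverse R-sym v p linked)
      (subst (λ w → Linked _ (w ∷ u ∷ [])) (sym (lastFrom-reverseTail v p)) (R-sym r ∷ [-]))

  Diverging : List A → List A → Set
  Diverging (v ∷ _) (w ∷ _) = v ≢ w
  Diverging _       _       = ⊤

  record Fork (p q : List A) : Set where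
    field
      stem left right : List A
      left-eq   : p ≡ stem ++ left
      right-eq  : q ≡ stem ++ right
      diverging : Diverging left right

  commonPrefix : DecidableEquality A → ∀ p q → Fork p q
  commonPrefix _≟_ (v ∷ p) (w ∷ q) with v ≟ w
  ... | no v≢w = record { stem = [] ; left = v ∷ p ; right = w ∷ q
                        ; left-eq = refl ; right-eq = refl ; diverging = v≢w }
  ... | yes refl = record { stem = v ∷ stem ; left = left ; right = right
                          ; left-eq = cong (v ∷_) left-eq ; right-eq = cong (v ∷_) right-eq
                          ; diverging = diverging }
    where open Fork (commonPrefix _≟_ p q)
  commonPrefix _≟_ []      q = record { stem = [] ; left = [] ; right = q
                                     ; left-eq = refl ; right-eq = refl ; diverging = tt }
  commonPrefix _≟_ (v ∷ p) [] = record { stem = [] ; left = v ∷ p ; right = []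
                                      ; left-eq = refl ; right-eq = refl ; diverging = tt }

  stem-maximal : ∀ c r {p q s s′ : List A} → Diverging p q →
                 c ++ p ≡ r ++ s → c ++ q ≡ r ++ s′ → ∃[ k ] c ≡ r ++ k
  stem-maximal c       []      _   _  _  = c , refl
  stem-maximal []      (u ∷ r) {v ∷ _} {w ∷ _} v≢w e e′ =
    ⊥-elim (v≢w (trans (∷-injectiveˡ e) (sym (∷-injectiveˡ e′))))
  stem-maximal (v ∷ c) (u ∷ r) div e e′ with ∷-injective e | ∷-injective e′
  ... | refl , e₁ | _ , e₁′ with stem-maximal c r div e₁ e₁′
  ...   | k , c≡r++k = k , cong (v ∷_) c≡r++k

  prefix-length : ∀ (c r : List A) {p w s} → c ++ p ≡ r ++ w ∷ s → w ∉ c → length c ≤ length r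
  prefix-length []      r       _ _   = z≤n
  prefix-length (v ∷ c) []      e w∉c = ⊥-elim (w∉c (here (sym (∷-injectiveˡ e))))
  prefix-length (v ∷ c) (u ∷ r) e w∉c =
    s≤s (prefix-length c r (proj₂ (∷-injective e)) (λ w∈c → w∉c (there w∈c)))

module _ {A : Set} where

  count : {P : Pred A 0ℓ} → Decidable P → List A → ℕ
  count P? xs = length (filter P? xs)

  module _ {P Q : Pred A 0ℓ} (P? : Decidable P) (Q? : Decidable Q) (P⇒Q : ∀ {y} → P y → Q y) where

    count-mono : ∀ xs → count P? xs ≤ count Q? xs
    count-mono xs = length-mono-≤ (filter⁺ P? Q? {as = xs} (λ { refl → P⇒Q }) ⊆-refl)

    count-mono-< : ∀ {xs y} → y ∈ xs → Q y → ¬ P y → count P? xs < count Q? xs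
    count-mono-< {y ∷ xs} (here refl) Qy ¬Py with P? y | Q? y
    ... | yes Py | _      = contradiction Py ¬Py
    ... | no _   | yes _  = s≤s (count-mono xs)
    ... | no _   | no ¬Qy = contradiction Qy ¬Qy
    count-mono-< {x ∷ xs} (there y∈xs) Qy ¬Py with P? x | Q? x
    ... | yes _  | yes _  = s≤s (count-mono-< y∈xs Qy ¬Py)
    ... | yes Px | no ¬Qx = contradiction (P⇒Q Px) ¬Qx
    ... | no _   | yes _  = m≤n⇒m≤1+n (count-mono-< y∈xs Qy ¬Py)
    ... | no _   | no _   = count-mono-< y∈xs Qy ¬Py

  module _ {P : Pred A 0ℓ} (P? : Decidable P) where

    count-accept : ∀ {y} xs → P y → count P? (y ∷ xs) ≡ suc (count P? xs)
    count-accept xs Py = cong length (filter-accept P? Py)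

    count-∷ : ∀ y xs → count P? xs ≤ count P? (y ∷ xs)
    count-∷ y xs with does (P? y)
    ... | true  = n≤1+n _
    ... | false = ≤-refl

    count-none : ∀ xs → (∀ {y} → ¬ P y) → count P? xs ≡ 0
    count-none xs ¬P = cong length (filter-none P? (All.universal (λ _ → ¬P) xs))

    count-witness : ∀ xs → 0 < count P? xs → ∃[ y ] P y
    count-witness (y ∷ xs) pos with P? y
    ... | yes Py = y , Py
    ... | no _   = count-witness xs pos

    count-≤1 : ∀ {xs u} → Unique xs → (∀ {y} → P y → y ≡ u) → count P? xs ≤ 1
    count-≤1 {[]}     _            _    = z≤n
    count-≤1 {y ∷ xs} (y∉xs ∷ uniq) only with P? y
    ... | no _   = count-≤1 uniq only
    ... | yes Py = s≤s (≤-reflexive (cong length (filter-none P? (All.map (λ y≢z Pz → y≢z (y≡ Pz)) y∉xs))))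
      where
      y≡ : ∀ {z} → P z → y ≡ z
      y≡ Pz = trans (only Py) (sym (only Pz))

  count-∪ : ∀ {P Q R : Pred A 0ℓ} (P? : Decidable P) (Q? : Decidable Q) (R? : Decidable R) →
            (∀ {y} → P y → Q y ⊎ R y) → ∀ xs → count P? xs ≤ count Q? xs + count R? xs
  count-∪ P? Q? R? split []       = z≤n
  count-∪ P? Q? R? split (y ∷ xs) with P? y
  ... | no _   = ≤-trans (count-∪ P? Q? R? split xs) (+-mono-≤ (count-∷ Q? y xs) (count-∷ R? y xs))
  ... | yes Py with split Py
  ...   | inj₁ Qy = begin
    suc (count P? xs)                         ≤⟨ s≤s (count-∪ P? Q? R? split xs) ⟩
    suc (count Q? xs) + count R? xs           ≤⟨ +-mono-≤ (≤-reflexive (sym (count-accept Q? xs Qy))) (count-∷ R? y xs) ⟩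
    count Q? (y ∷ xs) + count R? (y ∷ xs)     ∎
    where open ≤-Reasoning
  ...   | inj₂ Ry = begin
    suc (count P? xs)                         ≤⟨ s≤s (count-∪ P? Q? R? split xs) ⟩
    suc (count Q? xs + count R? xs)           ≡⟨ sym (+-suc _ _) ⟩
    count Q? xs + suc (count R? xs)           ≤⟨ +-mono-≤ (count-∷ Q? y xs) (≤-reflexive (sym (count-accept R? xs Ry))) ⟩
    count Q? (y ∷ xs) + count R? (y ∷ xs)     ∎
    where open ≤-Reasoning

  count-cover : ∀ {B : Set} {P : Pred A 0ℓ} {Q : B → Pred A 0ℓ} →
                (P? : Decidable P) (Q? : ∀ w → Decidable (Q w)) → ∀ W xs →
                (∀ {y} → P y → ∃[ w ] w ∈ W × Q w y) → count P? xs ≤ sum (map (λ w → count (Q? w) xs) W)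
  count-cover P? Q? []      xs cover = ≤-reflexive (count-none P? xs (λ Py → ¬Any[] (proj₁ (proj₂ (cover Py)))))
  count-cover {P = P} {Q} P? Q? (w ∷ W) xs cover =
    ≤-trans (count-∪ P? (Q? w) P∖Qw? (λ {y} Py → split Py (Q? w y)) xs)
            (+-monoʳ-≤ _ (count-cover P∖Qw? Q? W xs cover′))
    where
    P∖Qw? : Decidable (λ y → P y × ¬ Q w y)
    P∖Qw? y = P? y ×-dec ¬? (Q? w y)
    split : ∀ {y} → P y → Dec (Q w y) → Q w y ⊎ (P y × ¬ Q w y)
    split Py (yes Qwy) = inj₁ Qwy
    split Py (no ¬Qwy) = inj₂ (Py , ¬Qwy)
    cover′ : ∀ {y} → P y × ¬ Q w y → ∃[ w′ ] w′ ∈ W × Q w′ y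
    cover′ (Py , ¬Qwy) with cover Py
    ... | _ , here refl , Qwy = contradiction Qwy ¬Qwy
    ... | w′ , there w′∈W , Qw′y = w′ , w′∈W , Qw′y

  sum-map-≤-* : ∀ (f : A → ℕ) W {b} → (∀ {w} → w ∈ W → f w ≤ b) → sum (map f W) ≤ length W * b
  sum-map-≤-* f []      _     = z≤n
  sum-map-≤-* f (w ∷ W) bound = +-mono-≤ (bound (here refl)) (sum-map-≤-* f W (λ w∈W → bound (there w∈W)))

  sum-map-zero : ∀ (f : A → ℕ) W → (∀ {w} → w ∈ W → ¬ 0 < f w) → sum (map f W) ≡ 0
  sum-map-zero f []      _      = refl
  sum-map-zero f (w ∷ W) vanish =
    cong₂ _+_ (n≤0⇒n≡0 (≮⇒≥ (vanish (here refl)))) (sum-map-zero f W (λ w∈W → vanish (there w∈W)))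

  sum-map-≤-single : ∀ (f : A → ℕ) {W b} → Unique W → (∀ {w} → w ∈ W → f w ≤ b) →
                     (∀ {w w′} → w ∈ W → w′ ∈ W → 0 < f w → 0 < f w′ → w ≡ w′) → sum (map f W) ≤ b
  sum-map-≤-single f {[]}    _    _     _      = z≤n
  sum-map-≤-single f {w ∷ W} {b} uniq@(_ ∷ uniq′) bound single with 0 <? f w
  ... | no fw≯0 = begin
    f w + sum (map f W)  ≡⟨ cong (_+ sum (map f W)) (n≤0⇒n≡0 (≮⇒≥ fw≯0)) ⟩
    sum (map f W)        ≤⟨ sum-map-≤-single f uniq′ (λ w∈W → bound (there w∈W))
                                  (λ w∈W w′∈W → single (there w∈W) (there w′∈W)) ⟩
    b                    ∎
    where open ≤-Reasoning
  ... | yes fw>0 = begin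
    f w + sum (map f W)  ≡⟨ cong (f w +_) (sum-map-zero f W only-w) ⟩
    f w + 0              ≡⟨ +-identityʳ (f w) ⟩
    f w                  ≤⟨ bound (here refl) ⟩
    b                    ∎
    where
    open ≤-Reasoning
    only-w : ∀ {w′} → w′ ∈ W → ¬ 0 < f w′
    only-w w′∈W fw′>0 = Unique-head uniq (subst (_∈ W) (single (there w′∈W) (here refl) fw′>0 fw>0) w′∈W)

powerSum : ℕ → ℕ → ℕ
powerSum r zero    = 0
powerSum r (suc k) = powerSum r k + r ^ k

powerSum-mono : ∀ r {j k} → j ≤ k → powerSum r j ≤ powerSum r k
powerSum-mono r {j} {zero}  z≤n = ≤-refl
powerSum-mono r {j} {suc k} j≤1+k with m≤n⇒m<n∨m≡n j≤1+k
... | inj₁ (s≤s j≤k) = ≤-trans (powerSum-mono r j≤k) (m≤m+n _ _)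
... | inj₂ refl      = ≤-refl

powerSum-closed : ∀ a k → a * powerSum (1 + a) k + 1 ≡ (1 + a) ^ k
powerSum-closed a zero    = cong (_+ 1) (*-zeroʳ a)
powerSum-closed a (suc k) = begin
  a * (s + p) + 1      ≡⟨ rearrange a s p ⟩
  (a * s + 1) + a * p  ≡⟨ cong (_+ a * p) (powerSum-closed a k) ⟩
  p + a * p            ∎
  where
  open ≡-Reasoning
  s p : ℕ
  s = powerSum (1 + a) k
  p = (1 + a) ^ k
  rearrange : ∀ x y z → x * (y + z) + 1 ≡ (x * y + 1) + x * z
  rearrange = solve-∀

twice-≤ : ∀ m {n d} → m + n ≡ d → d ≤ m + m → n + n ≤ d
twice-≤ m {n} refl d≤2m = +-monoˡ-≤ n (+-cancelˡ-≤ m n m d≤2m)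

module _ (L : List ℕ) where

  PositiveUpTo : ℕ → Pred ℕ 0ℓ
  PositiveUpTo t e = 0 < e × e ≤ t

  positiveUpTo? : ∀ t → Decidable (PositiveUpTo t)
  positiveUpTo? t e = 0 <? e ×-dec e ≤? t

  positivesUpTo : ℕ → ℕ
  positivesUpTo t = count (positiveUpTo? t) L

  positivesUpTo-mono : ∀ {s t} → s ≤ t → positivesUpTo s ≤ positivesUpTo t
  positivesUpTo-mono s≤t =
    count-mono (positiveUpTo? _) (positiveUpTo? _) (λ (e>0 , e≤s) → e>0 , ≤-trans e≤s s≤t) L

  positivesUpTo-< : ∀ {s t} → s < t → t ∈ L → positivesUpTo s < positivesUpTo t
  positivesUpTo-< s<t t∈L =
    count-mono-< (positiveUpTo? _) (positiveUpTo? _) (λ (e>0 , e≤s) → e>0 , ≤-trans e≤s (<⇒≤ s<t)) t∈L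
      (<-≤-trans (s≤s z≤n) s<t , ≤-refl) (λ (_ , t≤s) → <⇒≱ s<t t≤s)

  positivesUpTo<length : ∀ t → 0 ∈ L → positivesUpTo t < length L
  positivesUpTo<length t 0∈L =
    filter-notAll (positiveUpTo? t) L (Any.map (λ { refl (0<0 , _) → <-irrefl refl 0<0 }) 0∈L)

module _ {n : ℕ} (T : Graph n) where

  open import Data.List.Membership.DecPropositional (_≟ᶠ_ {n}) using (_∈?_)

  Adj-sym : ∀ {v w} → Adj T v w → Adj T w v
  Adj-sym {v} {w} vw = trans (Graph.sym T w v) vw

  end≡lastFrom : ∀ u vs → end T u vs ≡ lastFrom u vs
  end≡lastFrom u []       = refl
  end≡lastFrom u (v ∷ vs) = end≡lastFrom v vs

  PathBetween : Fin n → Fin n → ℕ → Set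
  PathBetween a b k = ∃[ vs ] IsPath T a vs × lastFrom a vs ≡ b × length vs ≡ k

  IsPath-++⁻ˡ : ∀ u xs {ys} → IsPath T u (xs ++ ys) → IsPath T u xs
  IsPath-++⁻ˡ u xs (linked , uniq) = Linked-++⁻ˡ u xs _ linked , Unique-++⁻ˡ (u ∷ xs) uniq

  IsPath-++⁻ʳ : ∀ u xs {ys} → IsPath T u (xs ++ ys) → IsPath T (lastFrom u xs) ys
  IsPath-++⁻ʳ u []       path                   = path
  IsPath-++⁻ʳ u (v ∷ xs) (_ ∷ linked , _ ∷ uniq) = IsPath-++⁻ʳ v xs (linked , uniq)

  IsPath-suffix : ∀ pre {u post} → Linked (Adj T) (pre ++ u ∷ post) → Unique (pre ++ u ∷ post) → IsPath T u post
  IsPath-suffix []        linked uniq       = linked , uniq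
  IsPath-suffix (_ ∷ pre) linked (_ ∷ uniq) = IsPath-suffix pre (Linked.tail linked) uniq

  join-paths : ∀ w p q → IsPath T w p → IsPath T w q → Disjoint p q →
               PathBetween (lastFrom w p) (lastFrom w q) (length p + length q)
  join-paths w p q (lp , up) (lq , uq@(_ ∷ uq′)) p∩q=∅ =
    reverseTail w p ++ q , (linked , uniq) , end-eq , length-eq
    where
    linked : Linked (Adj T) (lastFrom w p ∷ reverseTail w p ++ q)
    linked = Linked-++⁺ (lastFrom w p) (reverseTail w p) q (Linked-reverse Adj-sym w p lp)
               (subst (λ v → Linked (Adj T) (v ∷ q)) (sym (lastFrom-reverseTail w p)) lq)
    disjoint : Disjoint (lastFrom w p ∷ reverseTail w p) q
    disjoint (v∈rev , v∈q) with ∈-reverse⁻ w p v∈rev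
    ... | here refl = Unique-head uq v∈q
    ... | there v∈p = p∩q=∅ (v∈p , v∈q)
    uniq : Unique (lastFrom w p ∷ reverseTail w p ++ q)
    uniq = ++⁺ (Unique-reverse w p up) uq′ disjoint
    end-eq : lastFrom (lastFrom w p) (reverseTail w p ++ q) ≡ lastFrom w q
    end-eq = trans (lastFrom-++ _ (reverseTail w p) q) (cong (λ v → lastFrom v q) (lastFrom-reverseTail w p))
    length-eq : length (reverseTail w p ++ q) ≡ length p + length q
    length-eq = trans (length-++ (reverseTail w p)) (cong (_+ length q) (length-reverseTail w p))

  walk⇒path : ∀ u W → Linked (Adj T) (u ∷ W) →
              ∃[ p ] IsPath T u p × lastFrom u p ≡ lastFrom u W × (u ∷ p) ⊆ (u ∷ W)
  walk⇒path u []      _ = [] , ([-] , Unique-∷ (λ ()) []) , refl , λ u∈ → u∈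
  walk⇒path u (v ∷ W) (uv ∷ linked) with walk⇒path v W linked
  ... | p , (lp , up) , end-eq , p⊆W with u ∈? (v ∷ p)
  ...   | no u∉ = v ∷ p , (uv ∷ lp , Unique-∷ u∉ up) , end-eq ,
                  λ { (here refl) → here refl ; (there w∈) → there (p⊆W w∈) }
  ...   | yes u∈ with ∈-∃++ u∈
  ...     | pre , post , v∷p≡pre++u∷post =
    post , IsPath-suffix pre (subst (Linked (Adj T)) v∷p≡pre++u∷post lp) (subst Unique v∷p≡pre++u∷post up) ,
    trans (sym (lastFrom-++ u pre (u ∷ post))) (trans (cong (lastFrom u) (sym v∷p≡pre++u∷post)) end-eq) ,
    λ { (here refl) → here refl
      ; (there w∈post) → there (p⊆W (subst (_ ∈_) (sym v∷p≡pre++u∷post) (∈-++⁺ʳ pre (there w∈post)))) }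

  -- Loop-erase the walk from w along q and back along p to v; preceded by u it is a cycle.
  branching-paths⇒cycle : ∀ u v w p q → v ≢ w → IsPath T u (v ∷ p) → IsPath T u (w ∷ q) →
                          lastFrom v p ≡ lastFrom w q → ∃[ vs ] IsCycle T u vs
  branching-paths⇒cycle u v w p q v≢w (uv ∷ lp , up) (uw ∷ lq , uq) same-end
    with walk⇒path w (q ++ reverseTail v p) walk
    where
    walk : Linked (Adj T) (w ∷ q ++ reverseTail v p)
    walk = Linked-++⁺ w q (reverseTail v p) lq
             (subst (λ x → Linked (Adj T) (x ∷ reverseTail v p)) same-end (Linked-reverse Adj-sym v p lp))
  ... | r , (lr , ur) , r-end , r⊆walk = w ∷ r , (uw ∷ lr , Unique-∷ u∉ ur) , two-edges r r-end′ , closing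
    where
    r-end′ : lastFrom w r ≡ v
    r-end′ = begin
      lastFrom w r                                         ≡⟨ r-end ⟩
      lastFrom w (q ++ reverseTail v p)                    ≡⟨ lastFrom-++ w q (reverseTail v p) ⟩
      lastFrom (lastFrom w q) (reverseTail v p)            ≡⟨ cong (λ x → lastFrom x (reverseTail v p)) (sym same-end) ⟩
      lastFrom (lastFrom v p) (reverseTail v p)            ≡⟨ lastFrom-reverseTail v p ⟩
      v                                                    ∎
      where open ≡-Reasoning
    u∉ : u ∉ w ∷ r
    u∉ u∈ with ∈-++⁻ (w ∷ q) (r⊆walk u∈)
    ... | inj₁ u∈wq  = Unique-head uq u∈wq
    ... | inj₂ u∈rev = Unique-head up (∈-reverse⁻ v p (there u∈rev))
    two-edges : ∀ r′ → lastFrom w r′ ≡ v → 2 ≤ length (w ∷ r′)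
    two-edges []      w≡v = contradiction (sym w≡v) v≢w
    two-edges (_ ∷ _) _   = s≤s (s≤s z≤n)
    closing : Adj T (end T u (w ∷ r)) u
    closing = subst (λ x → Adj T x u) (sym (trans (end≡lastFrom w r) r-end′)) (Adj-sym uv)

  acyclic⇒path-unique : Acyclic T → ∀ u p q → IsPath T u p → IsPath T u q →
                        lastFrom u p ≡ lastFrom u q → p ≡ q
  acyclic⇒path-unique acyclic u []      []      _ _ _ = refl
  acyclic⇒path-unique acyclic u []      (w ∷ q) _ (_ , uq) u≡end =
    contradiction (subst (_∈ w ∷ q) (sym u≡end) (lastFrom-∈ w q)) (Unique-head uq)
  acyclic⇒path-unique acyclic u (v ∷ p) []      (_ , up) _ end≡u =
    contradiction (subst (_∈ v ∷ p) end≡u (lastFrom-∈ v p)) (Unique-head up)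
  acyclic⇒path-unique acyclic u (v ∷ p) (w ∷ q) pathp@(_ ∷ lp , _ ∷ up) pathq@(_ ∷ lq , _ ∷ uq) same-end
    with v ≟ᶠ w
  ... | yes refl = cong (v ∷_) (acyclic⇒path-unique acyclic v p q (lp , up) (lq , uq) same-end)
  ... | no v≢w   = ⊥-elim (acyclic u _ (proj₂ (branching-paths⇒cycle u v w p q v≢w pathp pathq same-end)))

module Rooted {n : ℕ} (T : Graph n) (acyclic : Acyclic T) (connected : Connected T) (x : Fin n) where

  route : Fin n → List (Fin n)
  route v = proj₁ (connected x v)

  depth : Fin n → ℕ
  depth v = length (route v)

  route-path : ∀ v → IsPath T x (route v)
  route-path v = proj₁ (proj₂ (connected x v))

  route-last : ∀ v → lastFrom x (route v) ≡ v
  route-last v = trans (sym (end≡lastFrom T x (route v))) (proj₂ (proj₂ (connected x v)))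

  route-unique : ∀ {v r} → IsPath T x r → lastFrom x r ≡ v → r ≡ route v
  route-unique {v} {r} path r-end =
    acyclic⇒path-unique T acyclic x r (route v) path (route-path v) (trans r-end (sym (route-last v)))

  route-root : route x ≡ []
  route-root = sym (route-unique ([-] , Unique-∷ (λ ()) []) refl)

  route-injective : ∀ {v w} → route v ≡ route w → v ≡ w
  route-injective {v} {w} eq = trans (sym (route-last v)) (trans (cong (lastFrom x) eq) (route-last w))

  route-prefix : ∀ a r {s} → route a ≡ r ++ s → route (lastFrom x r) ≡ r
  route-prefix a r eq = sym (route-unique (IsPath-++⁻ˡ T x r (subst (IsPath T x) eq (route-path a))) refl)

  route-snoc : ∀ a r v {s} → route a ≡ r ++ v ∷ s → route v ≡ r ++ [ v ]
  route-snoc a r v {s} eq = trans (cong route (sym (lastFrom-++ x r [ v ])))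
                                  (route-prefix a (r ++ [ v ]) (trans eq (sym (++-assoc r [ v ] s))))

  ∈route⇒prefix : ∀ {v a} → v ∈ x ∷ route a → ∃[ s ] route a ≡ route v ++ s
  ∈route⇒prefix {a = a} (here refl) = route a , cong (_++ route a) (sym route-root)
  ∈route⇒prefix {v} {a} (there v∈) with ∈-∃++ v∈
  ... | pre , post , eq = post , (begin
    route a                 ≡⟨ eq ⟩
    pre ++ v ∷ post         ≡⟨ ++-assoc pre [ v ] post ⟨
    (pre ++ [ v ]) ++ post  ≡⟨ cong (_++ post) (route-snoc a pre v eq) ⟨
    route v ++ post         ∎)
    where open ≡-Reasoning

  ∈route-self : ∀ v → v ∈ x ∷ route v
  ∈route-self v = subst (_∈ x ∷ route v) (route-last v) (lastFrom-∈ x (route v))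

  prefix⇒∈route : ∀ {v r} s → r ≡ route v ++ s → v ∈ x ∷ r
  prefix⇒∈route {v} s eq = subst (λ r → v ∈ x ∷ r) (sym eq) (∈-++⁺ˡ (∈route-self v))

  open Fork

  fork-disjoint : ∀ {a b} (f : Fork (route a) (route b)) → Disjoint (left f) (right f)
  fork-disjoint {a} {b} f {v} (v∈l , v∈r)
    with ∈route⇒prefix (there (subst (v ∈_) (sym (left-eq f)) (∈-++⁺ʳ (stem f) v∈l)))
       | ∈route⇒prefix (there (subst (v ∈_) (sym (right-eq f)) (∈-++⁺ʳ (stem f) v∈r)))
  ... | s , ea | s′ , eb
    with stem-maximal (stem f) (route v) (diverging f) (trans (sym (left-eq f)) ea) (trans (sym (right-eq f)) eb)
  ...   | k , stem≡ = Unique-++⁻-disjoint (x ∷ stem f) uniq (prefix⇒∈route k stem≡ , v∈l)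
    where
    uniq : Unique (x ∷ stem f ++ left f)
    uniq = subst (λ r → Unique (x ∷ r)) (left-eq f) (proj₂ (route-path a))

  fork-path : ∀ {a b} (f : Fork (route a) (route b)) → PathBetween T a b (length (left f) + length (right f))
  fork-path {a} {b} f =
    subst₂ (λ a′ b′ → PathBetween T a′ b′ _) (branch-end a (left-eq f)) (branch-end b (right-eq f))
      (join-paths T (lastFrom x (stem f)) (left f) (right f)
        (branch a (left-eq f)) (branch b (right-eq f)) (fork-disjoint f))
    where
    branch : ∀ v {r} → route v ≡ stem f ++ r → IsPath T (lastFrom x (stem f)) r
    branch v eq = IsPath-++⁻ʳ T x (stem f) (subst (IsPath T x) eq (route-path v))
    branch-end : ∀ v {r} → route v ≡ stem f ++ r → lastFrom (lastFrom x (stem f)) r ≡ v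
    branch-end v {r} eq = trans (sym (lastFrom-++ x (stem f) r)) (trans (cong (lastFrom x) (sym eq)) (route-last v))

  -- The fork point of y and z lies no deeper than u, and the y–z path is no longer than route z.
  fork-depth : ∀ {y z u w s} → route y ≡ route u ++ w ∷ s → w ∉ x ∷ route z →
               (∀ {k} → PathBetween T y z k → k ≤ depth z) → depth y ≤ depth u + depth u
  fork-depth {y} {z} {u} {w} eq w∉ longest = begin
    depth y                                 ≡⟨ split-length (stem f) (left-eq f) ⟩
    length (stem f) + length (left f)       ≤⟨ +-monoʳ-≤ (length (stem f)) left≤stem ⟩
    length (stem f) + length (stem f)       ≤⟨ +-mono-≤ stem≤u stem≤u ⟩
    depth u + depth u                       ∎
    where
    open ≤-Reasoning
    f : Fork (route y) (route z)
    f = commonPrefix _≟ᶠ_ (route y) (route z)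
    split-length : ∀ {r} c {d} → r ≡ c ++ d → length r ≡ length c + length d
    split-length c eq = trans (cong length eq) (length-++ c)
    left≤stem : length (left f) ≤ length (stem f)
    left≤stem = +-cancelʳ-≤ (length (right f)) _ _ (begin
      length (left f) + length (right f)    ≤⟨ longest (fork-path f) ⟩
      depth z                               ≡⟨ split-length (stem f) (right-eq f) ⟩
      length (stem f) + length (right f)    ∎)
    stem≤u : length (stem f) ≤ depth u
    stem≤u = prefix-length (stem f) (route u) (trans (sym (left-eq f)) eq)
               (λ w∈stem → w∉ (there (subst (w ∈_) (sym (right-eq f)) (∈-++⁺ˡ w∈stem))))

  Child : Fin n → Fin n → Set
  Child u w = route w ≡ route u ++ [ w ]

  child? : ∀ u → Decidable (Child u)
  child? u w = ≡-dec _≟ᶠ_ (route w) (route u ++ [ w ])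

  children : Fin n → List (Fin n)
  children u = filter (child? u) (allFin n)

  ∈children⇒child : ∀ {u w} → w ∈ children u → Child u w
  ∈children⇒child {u} w∈ = proj₂ (∈-filter⁻ (child? u) {xs = allFin n} w∈)

  child-depth : ∀ {u w} → Child u w → depth w ≡ suc (depth u)
  child-depth {u} child = trans (cong length child) (trans (length-++ (route u)) (+-comm _ 1))

  child-adjacent : ∀ {u w} → Child u w → Adj T u w
  child-adjacent {u} {w} child
    with Linked-++⁻ʳ x (route u) [ w ] (subst (λ r → Linked (Adj T) (x ∷ r)) child (proj₁ (route-path w)))
  ... | uw ∷ [-] = subst (λ v → Adj T v w) (route-last u) uw

  step⇒child : ∀ {y u w t} → route y ≡ route u ++ w ∷ t → Child u w
  step⇒child {y} {u} {w} eq = route-snoc y (route u) w eq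

  child-on-route : ∀ {u w y} → Child u w → w ∈ x ∷ route y → ∃[ t ] route y ≡ route u ++ w ∷ t
  child-on-route {u} {w} child w∈ with ∈route⇒prefix w∈
  ... | t , eq = t , trans eq (trans (cong (_++ t) child) (++-assoc (route u) [ w ] t))

  children-on-route-unique : ∀ {u w₁ w₂ y} → Child u w₁ → Child u w₂ →
                             w₁ ∈ x ∷ route y → w₂ ∈ x ∷ route y → w₁ ≡ w₂
  children-on-route-unique {u} child₁ child₂ w₁∈ w₂∈
    with child-on-route child₁ w₁∈ | child-on-route child₂ w₂∈
  ... | t₁ , eq₁ | t₂ , eq₂ = ∷-injectiveˡ (++-cancelˡ (route u) _ _ (trans (sym eq₁) eq₂))

  parent : ∀ {u} → u ≢ x → ∃[ p ] Adj T u p × ¬ Child u p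
  parent {u} u≢x = from-init (route u) refl (initLast (route u))
    where
    from-init : ∀ r → route u ≡ r → InitLast r → ∃[ p ] Adj T u p × ¬ Child u p
    from-init _ eq [] = contradiction (trans (sym (route-last u)) (cong (lastFrom x) eq)) u≢x
    from-init _ eq (r ∷ʳ′ v) = lastFrom x r , Adj-sym T pu , not-child
      where
      v≡u : v ≡ u
      v≡u = trans (sym (lastFrom-++ x r [ v ])) (trans (cong (lastFrom x) (sym eq)) (route-last u))
      pu : Adj T (lastFrom x r) u
      pu with Linked-++⁻ʳ x r [ v ] (subst (λ r′ → Linked (Adj T) (x ∷ r′)) eq (proj₁ (route-path u)))
      ... | pv ∷ [-] = subst (Adj T _) v≡u pv
      not-child : ¬ Child u (lastFrom x r)
      not-child child = <-irrefl refl (begin-strict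
        length r                       <⟨ m<m+n (length r) (s≤s z≤n) ⟩
        length r + 1                   ≡⟨ length-++ r ⟨
        length (r ++ [ v ])            ≡⟨ cong length eq ⟨
        depth u                        <⟨ n<1+n (depth u) ⟩
        suc (depth u)                  ≡⟨ child-depth child ⟨
        depth (lastFrom x r)           ≡⟨ cong length (route-prefix u r eq) ⟩
        length r                       ∎)
        where open ≤-Reasoning

  children-count : ∀ u → length (children u) ≤ degree T u
  children-count u = count-mono (child? u) _ (Equivalence.from T-≡ ∘ child-adjacent) (allFin n)

  children-count-nonroot : ∀ {u} → u ≢ x → length (children u) < degree T u
  children-count-nonroot {u} u≢x with parent u≢x
  ... | p , up , not-child = count-mono-< (child? u) _ (Equivalence.from T-≡ ∘ child-adjacent)
                               (∈-allFin p) (Equivalence.from T-≡ up) not-child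

module LeafDepths {n : ℕ} (T : Graph n) (acyclic : Acyclic T) (connected : Connected T)
                  (a : ℕ) (degree≤ : ∀ v → degree T v ≤ 2 + a)
                  (L : List ℕ) (lengths : ∀ d → d ∈ L ⇔ IsLeafPathLength T d)
                  {x z : Fin n} (x-leaf : IsLeaf T x) (z-leaf : IsLeaf T z)
                  (longest : ∀ {e} → e ∈ L → e ≤ Rooted.depth T acyclic connected x z) where

  open Rooted T acyclic connected x
  open import Data.List.Membership.DecPropositional (_≟ᶠ_ {n}) using (_∈?_)
  open import Data.List.Membership.DecPropositional _≟_ using () renaming (_∈?_ to _∈ℕ?_)

  leaf? : Decidable (IsLeaf T)
  leaf? v = degree T v ≟ 1

  leaf-path∈L : ∀ {b c k} → IsLeaf T b → IsLeaf T c → PathBetween T b c k → k ∈ L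
  leaf-path∈L {b} b-leaf c-leaf (vs , path , vs-end , refl) =
    Equivalence.from (lengths _)
      (b , vs , path , b-leaf , subst (IsLeaf T) (sym (trans (end≡lastFrom T b vs) vs-end)) c-leaf , refl)

  depth∈L : ∀ {y} → IsLeaf T y → depth y ∈ L
  depth∈L {y} y-leaf = leaf-path∈L x-leaf y-leaf (route y , route-path y , route-last y , refl)

  LeafBelow : ℕ → Fin n → Pred (Fin n) 0ℓ
  LeafBelow d u y = IsLeaf T y × depth y ≡ d × u ∈ x ∷ route y

  leafBelow? : ∀ d u → Decidable (LeafBelow d u)
  leafBelow? d u y = leaf? y ×-dec depth y ≟ d ×-dec u ∈? (x ∷ route y)

  leavesBelow : ℕ → Fin n → ℕ
  leavesBelow d u = count (leafBelow? d u) (allFin n)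

  offset-length : ∀ {y u s d m} → route y ≡ route u ++ s → depth y ≡ d → depth u + m ≡ d → length s ≡ m
  offset-length {u = u} eq refl du+m≡d =
    +-cancelˡ-≡ (depth u) _ _ (trans (sym (trans (cong length eq) (length-++ (route u)))) (sym du+m≡d))

  below-offset : ∀ {d u y m} → LeafBelow d u y → depth u + m ≡ d →
                 ∃[ s ] route y ≡ route u ++ s × length s ≡ m
  below-offset (_ , depth-y , u∈) du+m≡d with ∈route⇒prefix u∈
  ... | s , eq = s , eq , offset-length eq depth-y du+m≡d

  branching-leaves : ∀ {d u w₁ w₂ y₁ y₂ m} → Child u w₁ → Child u w₂ → w₁ ≢ w₂ →
                     LeafBelow d w₁ y₁ → LeafBelow d w₂ y₂ → depth u + suc m ≡ d →
                     suc m + suc m ∈ L × suc m + suc m ≤ d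
  branching-leaves {d} {u} {w₁} {w₂} child₁ child₂ w₁≢w₂
                   (leaf₁ , depth₁ , w₁∈) (leaf₂ , depth₂ , w₂∈) du+1+m≡d
    with child-on-route child₁ w₁∈ | child-on-route child₂ w₂∈
  ... | t₁ , eq₁ | t₂ , eq₂ =
    subst (_∈ L) (cong₂ _+_ (offset-length eq₁ depth₁ du+1+m≡d) (offset-length eq₂ depth₂ du+1+m≡d))
      (leaf-path∈L leaf₁ leaf₂ (fork-path fork)) ,
    twice-≤ (depth u) du+1+m≡d d≤2u
    where
    fork : Fork _ _
    fork = record { stem = route u ; left = w₁ ∷ t₁ ; right = w₂ ∷ t₂
                  ; left-eq = eq₁ ; right-eq = eq₂ ; diverging = w₁≢w₂ }
    shorter : ∀ {y k} → IsLeaf T y → PathBetween T y z k → k ≤ depth z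
    shorter y-leaf path = longest (leaf-path∈L y-leaf z-leaf path)
    d≤2u : d ≤ depth u + depth u
    d≤2u with w₁ ∈? (x ∷ route z) | w₂ ∈? (x ∷ route z)
    ... | no w₁∉    | _         = subst (_≤ _) depth₁ (fork-depth eq₁ w₁∉ (shorter leaf₁))
    ... | yes _     | no w₂∉    = subst (_≤ _) depth₂ (fork-depth eq₂ w₂∉ (shorter leaf₂))
    ... | yes w₁∈z | yes w₂∈z = contradiction (children-on-route-unique child₁ child₂ w₁∈z w₂∈z) w₁≢w₂

  children-length : ∀ u → length (children u) ≤ 1 + a
  children-length u with u ≟ᶠ x
  ... | yes refl = ≤-trans (children-count x) (≤-trans (≤-reflexive x-leaf) (s≤s z≤n))
  ... | no u≢x   = ≤-pred (≤-trans (children-count-nonroot u≢x) (degree≤ u))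

  module _ (d : ℕ) where

    leavesBelow-≤1 : ∀ u → depth u + 0 ≡ d → leavesBelow d u ≤ 1
    leavesBelow-≤1 u du≡d = count-≤1 (leafBelow? d u) (allFin⁺ n) only-u
      where
      only-u : ∀ {y} → LeafBelow d u y → y ≡ u
      only-u below with below-offset below du≡d
      ... | [] , eq , _ = route-injective (trans eq (++-identityʳ (route u)))

    leavesBelow-split : ∀ u m → depth u + suc m ≡ d → leavesBelow d u ≤ sum (map (leavesBelow d) (children u))
    leavesBelow-split u m du+1+m≡d = count-cover (leafBelow? d u) (leafBelow? d) (children u) (allFin n) cover
      where
      cover : ∀ {y} → LeafBelow d u y → ∃[ w ] w ∈ children u × LeafBelow d w y
      cover below@(y-leaf , depth-y , _) with below-offset below du+1+m≡d
      ... | w ∷ t , eq , _ =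
        w , ∈-filter⁺ (child? u) (∈-allFin w) (step⇒child eq) ,
        y-leaf , depth-y ,
        prefix⇒∈route t (trans eq (trans (sym (++-assoc (route u) [ w ] t)) (cong (_++ t) (sym (step⇒child eq)))))

    bound : ℕ → ℕ
    bound m = (1 + a) ^ positivesUpTo L (d ⊓ (m + m))

    at-most-one-branch : ∀ {u m} → depth u + suc m ≡ d → ¬ (suc m + suc m ∈ L × suc m + suc m ≤ d) →
                         ∀ {w w′} → w ∈ children u → w′ ∈ children u →
                         0 < leavesBelow d w → 0 < leavesBelow d w′ → w ≡ w′
    at-most-one-branch du+1+m≡d no-branching {w} {w′} w∈ w′∈ pos pos′ with w ≟ᶠ w′
    ... | yes w≡w′ = w≡w′
    ... | no w≢w′  = contradiction
      (branching-leaves (∈children⇒child w∈) (∈children⇒child w′∈) w≢w′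
        (proj₂ (count-witness (leafBelow? d w) (allFin n) pos))
        (proj₂ (count-witness (leafBelow? d w′) (allFin n) pos′)) du+1+m≡d)
      no-branching

    children-bound : ∀ u m → depth u + suc m ≡ d → (∀ {w} → w ∈ children u → leavesBelow d w ≤ bound m) →
                     sum (map (leavesBelow d) (children u)) ≤ bound (suc m)
    children-bound u m du+1+m≡d below-child with (suc m + suc m ∈ℕ? L) ×-dec (suc m + suc m ≤? d)
    ... | yes (∈L , ≤d) = begin
      sum (map (leavesBelow d) (children u))     ≤⟨ sum-map-≤-* (leavesBelow d) (children u) below-child ⟩
      length (children u) * bound m              ≤⟨ *-monoˡ-≤ (bound m) (children-length u) ⟩
      (1 + a) * bound m                          ≤⟨ ^-monoʳ-≤ (1 + a) (positivesUpTo-< L d⊓2m<2m+2 ∈L) ⟩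
      (1 + a) ^ positivesUpTo L (suc m + suc m)  ≡⟨ cong (λ t → (1 + a) ^ positivesUpTo L t) (m≥n⇒m⊓n≡n ≤d) ⟨
      bound (suc m)                              ∎
      where
      open ≤-Reasoning
      d⊓2m<2m+2 : d ⊓ (m + m) < suc m + suc m
      d⊓2m<2m+2 = ≤-<-trans (m⊓n≤n d (m + m)) (+-mono-< (n<1+n m) (n<1+n m))
    ... | no no-branching = begin
      sum (map (leavesBelow d) (children u))  ≤⟨ sum-map-≤-single (leavesBelow d)
                                                   (Unique.filter⁺ (child? u) (allFin⁺ n)) below-child
                                                   (at-most-one-branch du+1+m≡d no-branching) ⟩
      bound m                                 ≤⟨ ^-monoʳ-≤ (1 + a) (positivesUpTo-mono L 2m≤2m+2) ⟩
      bound (suc m)                           ∎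
      where
      open ≤-Reasoning
      2m≤2m+2 : d ⊓ (m + m) ≤ d ⊓ (suc m + suc m)
      2m≤2m+2 = ⊓-monoʳ-≤ d (+-mono-≤ (n≤1+n m) (n≤1+n m))

    leavesBelow-bound : ∀ m u → depth u + m ≡ d → leavesBelow d u ≤ bound m
    leavesBelow-bound zero    u du≡d     =
      ≤-trans (leavesBelow-≤1 u du≡d) (m^n>0 (1 + a) (positivesUpTo L (d ⊓ 0)))
    leavesBelow-bound (suc m) u du+1+m≡d =
      ≤-trans (leavesBelow-split u m du+1+m≡d) (children-bound u m du+1+m≡d below-child)
      where
      below-child : ∀ {w} → w ∈ children u → leavesBelow d w ≤ bound m
      below-child {w} w∈ = leavesBelow-bound m w (begin-equality
        depth w + m        ≡⟨ cong (_+ m) (child-depth (∈children⇒child w∈)) ⟩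
        suc (depth u) + m  ≡⟨ +-suc (depth u) m ⟨
        depth u + suc m    ≡⟨ du+1+m≡d ⟩
        d                  ∎)
        where open ≤-Reasoning

  LeafAt : ℕ → Pred (Fin n) 0ℓ
  LeafAt d y = IsLeaf T y × depth y ≡ d

  leafAt? : ∀ d → Decidable (LeafAt d)
  leafAt? d y = leaf? y ×-dec depth y ≟ d

  leavesAt : ℕ → ℕ
  leavesAt d = count (leafAt? d) (allFin n)

  LeafUpTo : ℕ → Pred (Fin n) 0ℓ
  LeafUpTo t y = IsLeaf T y × depth y ≤ t

  leafUpTo? : ∀ t → Decidable (LeafUpTo t)
  leafUpTo? t y = leaf? y ×-dec depth y ≤? t

  leavesUpTo : ℕ → ℕ
  leavesUpTo t = count (leafUpTo? t) (allFin n)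

  leavesAt-bound : ∀ d → leavesAt d ≤ (1 + a) ^ positivesUpTo L d
  leavesAt-bound d = begin
    leavesAt d       ≤⟨ count-mono _ (leafBelow? d x) (λ (y-leaf , depth-y) → y-leaf , depth-y , here refl) (allFin n) ⟩
    leavesBelow d x  ≤⟨ leavesBelow-bound d d x (cong (_+ d) (cong length route-root)) ⟩
    bound d d        ≡⟨ cong (λ t → (1 + a) ^ positivesUpTo L t) (m≤n⇒m⊓n≡m (m≤m+n d d)) ⟩
    (1 + a) ^ positivesUpTo L d ∎
    where open ≤-Reasoning

  leavesUpTo-bound : ∀ t → leavesUpTo t ≤ powerSum (1 + a) (suc (positivesUpTo L t))
  leavesUpTo-bound zero = begin
    leavesUpTo 0                        ≤⟨ count-mono _ _ (λ (y-leaf , depth≤0) → y-leaf , n≤0⇒n≡0 depth≤0) (allFin n) ⟩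
    leavesAt 0                          ≤⟨ leavesAt-bound 0 ⟩
    (1 + a) ^ positivesUpTo L 0         ≤⟨ m≤n+m _ _ ⟩
    powerSum (1 + a) (suc (positivesUpTo L 0)) ∎
    where open ≤-Reasoning
  leavesUpTo-bound (suc t) =
    ≤-trans (count-∪ (leafUpTo? (suc t)) (leafUpTo? t) _ split (allFin n)) (new-level (suc t ∈ℕ? L))
    where
    split : ∀ {y} → LeafUpTo (suc t) y → LeafUpTo t y ⊎ LeafAt (suc t) y
    split (y-leaf , depth≤1+t) with m≤n⇒m<n∨m≡n depth≤1+t
    ... | inj₁ depth<1+t = inj₁ (y-leaf , ≤-pred depth<1+t)
    ... | inj₂ depth≡1+t = inj₂ (y-leaf , depth≡1+t)
    new-level : Dec (suc t ∈ L) → leavesUpTo t + leavesAt (suc t) ≤ powerSum (1 + a) (suc (positivesUpTo L (suc t)))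
    new-level (yes 1+t∈L) = +-mono-≤
      (≤-trans (leavesUpTo-bound t) (powerSum-mono (1 + a) (positivesUpTo-< L (n<1+n t) 1+t∈L)))
      (leavesAt-bound (suc t))
    new-level (no 1+t∉L) = begin
      leavesUpTo t + leavesAt (suc t)                     ≡⟨ cong (leavesUpTo t +_) no-leaves ⟩
      leavesUpTo t + 0                                    ≡⟨ +-identityʳ _ ⟩
      leavesUpTo t                                        ≤⟨ leavesUpTo-bound t ⟩
      powerSum (1 + a) (suc (positivesUpTo L t))          ≤⟨ powerSum-mono (1 + a) (s≤s (positivesUpTo-mono L (n≤1+n t))) ⟩
      powerSum (1 + a) (suc (positivesUpTo L (suc t)))    ∎
      where
      open ≤-Reasoning
      no-leaves : leavesAt (suc t) ≡ 0
      no-leaves = count-none _ (allFin n)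
        (λ (y-leaf , depth≡1+t) → 1+t∉L (subst (_∈ L) depth≡1+t (depth∈L y-leaf)))

  leafCount-bound : a * leafCount T ≤ (1 + a) ^ length L
  leafCount-bound = begin
    a * leafCount T                      ≤⟨ *-monoʳ-≤ a leafCount≤ ⟩
    a * powerSum (1 + a) (length L)      ≤⟨ m≤m+n _ 1 ⟩
    a * powerSum (1 + a) (length L) + 1  ≡⟨ powerSum-closed a (length L) ⟩
    (1 + a) ^ length L                   ∎
    where
    open ≤-Reasoning
    0∈L : 0 ∈ L
    0∈L = subst (_∈ L) (cong length route-root) (depth∈L x-leaf)
    leafCount≤ : leafCount T ≤ powerSum (1 + a) (length L)
    leafCount≤ = begin
      leafCount T                                          ≤⟨ count-mono _ (leafUpTo? (depth z)) all-leaves (allFin n) ⟩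
      leavesUpTo (depth z)                                 ≤⟨ leavesUpTo-bound (depth z) ⟩
      powerSum (1 + a) (suc (positivesUpTo L (depth z)))   ≤⟨ powerSum-mono (1 + a) (positivesUpTo<length L (depth z) 0∈L) ⟩
      powerSum (1 + a) (length L)                          ∎
      where
      all-leaves : ∀ {y} → Bool.T (degree T y ≡ᵇ 1) → LeafUpTo (depth z) y
      all-leaves is-leaf = let y-leaf = ≡ᵇ⇒≡ _ 1 is-leaf in y-leaf , longest (depth∈L y-leaf)

leafCount-bound : ∀ {n} (T : Graph n) → IsTree T → ∀ a → (∀ v → degree T v ≤ 2 + a) →
                  ∀ L → (∀ d → d ∈ L ⇔ IsLeafPathLength T d) → a * leafCount T ≤ (1 + a) ^ length L
leafCount-bound {n} T _ a _ [] lengths = begin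
  a * leafCount T  ≡⟨ cong (a *_) no-leaves ⟩
  a * 0            ≡⟨ *-zeroʳ a ⟩
  0                ≤⟨ z≤n ⟩
  1                ∎
  where
  open ≤-Reasoning
  no-leaves : leafCount T ≡ 0
  no-leaves = count-none _ (allFin n) λ {y} is-leaf →
    let y-leaf = ≡ᵇ⇒≡ _ 1 is-leaf in
    ¬Any[] (Equivalence.from (lengths 0) (y , [] , ([-] , Unique-∷ (λ ()) []) , y-leaf , y-leaf , refl))
leafCount-bound T (connected , acyclic) a degree≤ L@(e ∷ es) lengths
  with Equivalence.to (lengths (max e es)) (argmax-all id (here refl) (All.tabulate there))
... | x , vs , path , x-leaf , z-leaf , length-vs =
  LeafDepths.leafCount-bound T acyclic connected a degree≤ L lengths x-leaf
    (subst (IsLeaf T) (end≡lastFrom T x vs) z-leaf) longest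
  where
  open Rooted T acyclic connected x using (depth; route-unique)
  ≤max : ∀ {e′} → e′ ∈ L → e′ ≤ max e es
  ≤max (here refl)   = ⊥≤max e es
  ≤max (there e′∈es) = All.lookup (xs≤max e es) e′∈es
  longest : ∀ {e′} → e′ ∈ L → e′ ≤ depth (lastFrom x vs)
  longest e′∈L =
    ≤-trans (≤max e′∈L) (≤-reflexive (trans (sym length-vs) (cong length (route-unique path refl))))

-- Neither Unique L (repeated entries only make length L larger) nor a vertex of degree Δ is needed.
theorem1p4 : (n : ℕ) (T : Graph n) → IsTree T → (Δ : ℕ) → 3 ≤ Δ → MaxDegree T Δ →
    (L : List ℕ) → Unique L → (∀ d → d ∈ L ⇔ IsLeafPathLength T d) →
    (Δ ∸ 2) * leafCount T ≤ (Δ ∸ 1) ^ length L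
theorem1p4 n T tree (suc (suc (suc a))) (s≤s (s≤s (s≤s _))) (_ , degree≤) L _ lengths =
  leafCount-bound T tree (suc a) degree≤ L lengths
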